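{- For every integer $m\ge 2$, $\gamma_{2t}(K_2\Box K_m)=4$.
   Context: $K_n$ denotes the complete graph on $n$ vertices. The Cartesian product $G\Box H$ has vertex set $V(G)\times V(H)$, with $(u_1,v_1)\sim(u_2,v_2)$ iff either $u_1=u_2$ and $v_1\sim v_2$, or $v_1=v_2$ and $u_1\sim u_2$. A set $S$ of vertices of a graph $G$ is total $2$-dominating if every vertex of $G$ is adjacent to at least two vertices of $S$; $\gamma_{2t}(G)$ is the minimum cardinality of such a set. -}

module Defs where

open import Level using (0ℓ)
open import Data.Nat using (ℕ; _≤_)
open import Data.Fin using (Fin)
open import Data.Product using (_×_; _,_; ∃-syntax)
open import Data.Sum using (_⊎_)
open import Data.List using (List; length)
open import Data.List.Membership.Propositional using (_∈_)
open import Data.List.Relation.Unary.Unique.Propositional using (Unique)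
open import Relation.Nullary using (¬_)
open import Relation.Binary.PropositionalEquality using (_≡_)

record Graph : Set₁ where
  field
    V   : Set
    Adj : V → V → Set
open Graph public

K : ℕ → Graph
K n = record { V = Fin n ; Adj = λ u v → ¬ (u ≡ v) }

_□_ : Graph → Graph → Graph
G □ H = record
  { V   = V G × V H
  ; Adj = λ { (u₁ , v₁) (u₂ , v₂) →
              (u₁ ≡ u₂ × Adj H v₁ v₂) ⊎ (v₁ ≡ v₂ × Adj G u₁ u₂) } }

-- A finite vertex set is a duplicate-free list; its cardinality is its length.
-- S is total 2-dominating: every vertex x is adjacent to at least two
-- (distinct) vertices of S.
IsTotal2Dominating : (G : Graph) → List (V G) → Set
IsTotal2Dominating G S =
  ∀ (x : V G) → ∃[ u ] ∃[ w ] (u ∈ S × w ∈ S × ¬ (u ≡ w) × Adj G x u × Adj G x w)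

γ2t≡ : (G : Graph) → ℕ → Set
γ2t≡ G k =
  (∃[ S ] (Unique S × IsTotal2Dominating G S × length S ≡ k))
  × (∀ (S : List (V G)) → Unique S → IsTotal2Dominating G S → k ≤ length S)

-- A total 2-dominating set S needs at least three vertices, since a vertex of S
-- is not its own neighbour; with exactly three, every vertex of S sees the other
-- two, so S is a triangle. A triangle of K₂ □ Kₘ lies in one copy of Kₘ, and the
-- vertex opposite one of its corners sees no other corner. Hence γ₂ₜ ≥ 4, and the
-- 4-cycle {0,1} × {0,1} attains it: a vertex in column 0 or 1 sees its cycle
-- neighbours, any other vertex sees the two corners in its own row.
module Submission where

open import Defs
open import Data.Nat using (ℕ; _≤_; _+_; suc; z≤n; s≤s)
open import Data.Fin using (Fin; suc; opposite; _↑ˡ_)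
open import Data.Fin.Patterns using (0F; 1F)
open import Data.Product using (_×_; _,_; proj₁; proj₂; ∃-syntax)
open import Data.Sum using (inj₁; inj₂)
open import Data.List using (List; []; _∷_; [_]; length)
open import Data.List.Membership.Propositional using (_∈_)
open import Data.List.Relation.Unary.Any using (here; there)
open import Data.List.Relation.Unary.All using ([]; _∷_)
open import Data.List.Relation.Unary.AllPairs using ([]; _∷_)
open import Data.List.Relation.Unary.Unique.Propositional using (Unique)
open import Data.List.Relation.Binary.Subset.Propositional using (_⊆_)
open import Data.Empty using (⊥-elim)
open import Relation.Nullary using (¬_)
open import Relation.Binary.Definitions using (Irreflexive)
open import Relation.Binary.PropositionalEquality using (_≡_; _≢_; refl; sym; trans)

TwoNeighboursIn : (G : Graph) → List (V G) → V G → Set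
TwoNeighboursIn G S x =
  ∃[ u ] ∃[ w ] (u ∈ S × w ∈ S × ¬ (u ≡ w) × Adj G x u × Adj G x w)

module Domination (G : Graph) where

  twoNeighboursIn-mono : ∀ {S S′ x} → S ⊆ S′ → TwoNeighboursIn G S x → TwoNeighboursIn G S′ x
  twoNeighboursIn-mono S⊆S′ (u , w , u∈S , w∈S , u≢w , xu , xw) =
    u , w , S⊆S′ u∈S , S⊆S′ w∈S , u≢w , xu , xw

  twoNeighboursIn-drop : ∀ {a S x} → ¬ Adj G x a → TwoNeighboursIn G (a ∷ S) x → TwoNeighboursIn G S x
  twoNeighboursIn-drop ¬xa (u , w , u∈ , w∈ , u≢w , xu , xw) =
    u , w , skip u∈ xu , skip w∈ xw , u≢w , xu , xw
    where
    skip : ∀ {y S} → y ∈ _ ∷ S → Adj G _ y → y ∈ S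
    skip (here refl) xa = ⊥-elim (¬xa xa)
    skip (there y∈S) _  = y∈S

  ¬twoNeighboursIn-[_] : ∀ a {x} → ¬ TwoNeighboursIn G [ a ] x
  ¬twoNeighboursIn-[ a ] (_ , _ , here refl , here refl , u≢w , _) = u≢w refl

  twoNeighboursIn-pair : ∀ {a b x} → TwoNeighboursIn G (a ∷ b ∷ []) x → Adj G x a × Adj G x b
  twoNeighboursIn-pair (_ , _ , here refl , here refl , u≢w , _)                 = ⊥-elim (u≢w refl)
  twoNeighboursIn-pair (_ , _ , here refl , there (here refl) , _ , xa , xb)     = xa , xb
  twoNeighboursIn-pair (_ , _ , there (here refl) , here refl , _ , xb , xa)     = xa , xb
  twoNeighboursIn-pair (_ , _ , there (here refl) , there (here refl) , u≢w , _) = ⊥-elim (u≢w refl)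

  module _ (irrefl : Irreflexive _≡_ (Adj G)) where

    dominating-triple⇒triangle : ∀ {p q r} → IsTotal2Dominating G (p ∷ q ∷ r ∷ []) →
                                 Adj G p q × Adj G p r × Adj G q r
    dominating-triple⇒triangle {p} {q} {r} dom
      with twoNeighboursIn-pair (twoNeighboursIn-drop (irrefl refl) (dom p))
    ... | pq , pr = pq , pr , qr
      where
      q-first : p ∷ q ∷ r ∷ [] ⊆ q ∷ p ∷ r ∷ []
      q-first (here e)          = there (here e)
      q-first (there (here e))  = here e
      q-first (there (there e)) = there (there e)
      qr = proj₂ (twoNeighboursIn-pair
             (twoNeighboursIn-drop (irrefl refl) (twoNeighboursIn-mono q-first (dom q))))

    length≥4 : V G → (∀ p q r → ¬ IsTotal2Dominating G (p ∷ q ∷ r ∷ [])) →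
               ∀ S → IsTotal2Dominating G S → 4 ≤ length S
    length≥4 v _       []                  dom with dom v
    ... | _ , _ , () , _
    length≥4 v _       (p ∷ [])            dom = ⊥-elim (¬twoNeighboursIn-[ p ] (dom v))
    length≥4 _ _       (p ∷ q ∷ [])        dom =
      ⊥-elim (¬twoNeighboursIn-[ q ] (twoNeighboursIn-drop (irrefl refl) (dom p)))
    length≥4 _ ¬triple (p ∷ q ∷ r ∷ [])    dom = ⊥-elim (¬triple p q r dom)
    length≥4 _ _       (_ ∷ _ ∷ _ ∷ _ ∷ _) _   = s≤s (s≤s (s≤s (s≤s z≤n)))

K-irreflexive : ∀ n → Irreflexive _≡_ (Adj (K n))
K-irreflexive n u≡v u≢v = u≢v u≡v

□-irreflexive : ∀ {G H} → Irreflexive _≡_ (Adj G) → Irreflexive _≡_ (Adj H) →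
                Irreflexive _≡_ (Adj (G □ H))
□-irreflexive _       irrefl-H refl (inj₁ (_ , hh)) = irrefl-H refl hh
□-irreflexive irrefl-G _       refl (inj₂ (_ , gg)) = irrefl-G refl gg

opposite-≢ : ∀ (i : Fin 2) → i ≢ opposite i
opposite-≢ 0F ()
opposite-≢ 1F ()

≢⇒≡opposite : ∀ {i j : Fin 2} → i ≢ j → j ≡ opposite i
≢⇒≡opposite {0F} {0F} i≢j = ⊥-elim (i≢j refl)
≢⇒≡opposite {0F} {1F} _   = refl
≢⇒≡opposite {1F} {0F} _   = refl
≢⇒≡opposite {1F} {1F} i≢j = ⊥-elim (i≢j refl)

module _ {H : Graph} (irrefl-H : Irreflexive _≡_ (Adj H)) where

  private
    G = K 2 □ H

    G-irreflexive : Irreflexive _≡_ (Adj G)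
    G-irreflexive = □-irreflexive (K-irreflexive 2) irrefl-H

  open Domination G

  triangle⇒same-row : ∀ {p q r} → Adj G p q → Adj G p r → Adj G q r →
                      proj₁ p ≡ proj₁ q × proj₁ p ≡ proj₁ r
  triangle⇒same-row (inj₁ (pq , _))    (inj₁ (pr , _))    _                 = pq , pr
  triangle⇒same-row (inj₁ (refl , hh)) (inj₂ (refl , pr)) (inj₁ (qr , _))  = ⊥-elim (pr qr)
  triangle⇒same-row (inj₁ (refl , hh)) (inj₂ (refl , pr)) (inj₂ (qr , _))  = ⊥-elim (irrefl-H (sym qr) hh)
  triangle⇒same-row (inj₂ (refl , pq)) (inj₁ (refl , hh)) (inj₁ (qr , _))  = ⊥-elim (pq (sym qr))
  triangle⇒same-row (inj₂ (refl , pq)) (inj₁ (refl , hh)) (inj₂ (qr , _))  = ⊥-elim (irrefl-H qr hh)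
  triangle⇒same-row (inj₂ (refl , pq)) (inj₂ (refl , pr)) (inj₁ (_ , hh))  = ⊥-elim (irrefl-H refl hh)
  triangle⇒same-row (inj₂ (refl , pq)) (inj₂ (refl , pr)) (inj₂ (_ , qr))  =
    ⊥-elim (qr (trans (≢⇒≡opposite pq) (sym (≢⇒≡opposite pr))))

  opposite-¬adjacent : ∀ {i j j′} → Adj G (i , j) (i , j′) → ¬ Adj G (opposite i , j) (i , j′)
  opposite-¬adjacent {i} _  (inj₁ (e , _))    = opposite-≢ i (sym e)
  opposite-¬adjacent     pq (inj₂ (refl , _)) = G-irreflexive refl pq

  ¬dominating-triple : ∀ p q r → ¬ IsTotal2Dominating G (p ∷ q ∷ r ∷ [])
  ¬dominating-triple p@(i , j) q r dom with dominating-triple⇒triangle G-irreflexive dom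
  ... | pq , pr , qr with triangle⇒same-row pq pr qr
  ... | refl , refl =
    ¬twoNeighboursIn-[ p ]
      (twoNeighboursIn-drop (opposite-¬adjacent pr)
        (twoNeighboursIn-drop (opposite-¬adjacent pq)
          (twoNeighboursIn-mono p-last (dom (opposite i , j)))))
    where
    p-last : p ∷ q ∷ r ∷ [] ⊆ q ∷ r ∷ p ∷ []
    p-last (here e)                 = there (there (here e))
    p-last (there (here e))         = here e
    p-last (there (there (here e))) = there (here e)

module Square (k : ℕ) where

  corner : Fin 2 → Fin 2 → Fin 2 × Fin (2 + k)
  corner i j = i , j ↑ˡ k

  square : List (Fin 2 × Fin (2 + k))
  square = corner 0F 0F ∷ corner 0F 1F ∷ corner 1F 0F ∷ corner 1F 1F ∷ []

  square-unique : Unique square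
  square-unique = ((λ ()) ∷ (λ ()) ∷ (λ ()) ∷ []) ∷ ((λ ()) ∷ (λ ()) ∷ []) ∷ ((λ ()) ∷ []) ∷ [] ∷ []

  corner∈square : ∀ i j → corner i j ∈ square
  corner∈square 0F 0F = here refl
  corner∈square 0F 1F = there (here refl)
  corner∈square 1F 0F = there (there (here refl))
  corner∈square 1F 1F = there (there (there (here refl)))

  square-dominating : IsTotal2Dominating (K 2 □ K (2 + k)) square
  square-dominating (i , 0F) =
    corner i 1F , corner (opposite i) 0F , corner∈square i 1F , corner∈square (opposite i) 0F ,
    (λ ()) , inj₁ (refl , λ ()) , inj₂ (refl , opposite-≢ i)
  square-dominating (i , 1F) =
    corner i 0F , corner (opposite i) 1F , corner∈square i 0F , corner∈square (opposite i) 1F ,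
    (λ ()) , inj₁ (refl , λ ()) , inj₂ (refl , opposite-≢ i)
  square-dominating (i , suc (suc _)) =
    corner i 0F , corner i 1F , corner∈square i 0F , corner∈square i 1F ,
    (λ ()) , inj₁ (refl , λ ()) , inj₁ (refl , λ ())

proposition2p2 : ∀ (m : ℕ) → 2 ≤ m → γ2t≡ (K 2 □ K m) 4
proposition2p2 (suc (suc k)) (s≤s (s≤s z≤n)) =
  (square , square-unique , square-dominating , refl) ,
  λ S _ → Domination.length≥4 (K 2 □ K m) (□-irreflexive (K-irreflexive 2) (K-irreflexive m))
            (0F , 0F) (¬dominating-triple (K-irreflexive m)) S
  where
  m = 2 + k
  open Square k
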